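{- Consider any fractional algorithm for online matching with general vertex arrivals run on the following adversarial construction with parameters $n,k$. First stage: a set $A$ of $nk$ vertices arrives, forming a complete bipartite graph with equal-size sides; let $\gamma$ be the average matched portion of the vertices of $A$ after the first stage. Second stage: for $i=1,\dots,n$, a set $B_i$ of $k$ new vertices arrives (one by one), each adjacent exactly to the vertices of $A\setminus\bigcup_{j<i}A_j$; after the algorithm's decisions on the arrival of $B_i$, let $A_i$ be a set of $k$ least matched vertices among $A\setminus\bigcup_{j<i}A_j$. Let $\alpha_i,\beta_i$ be the average matched portions of the vertices in $A_i$ and $B_i$ respectively after the second stage. Then (1) for every $i\in[n-1]$: $\sum_{j=1}^{i-1}\alpha_j+(n-i+1)\alpha_i\le\sum_{j=1}^{i}\beta_j+n\gamma$; (2) $\sum_{i=1}^{n}\alpha_i=n\gamma+\sum_{i=1}^{n}\beta_i$.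
   Context: Online matching with general vertex arrival (fractional): vertices arrive one at a time; upon arrival of $v$, edges between $v$ and previously arrived vertices are revealed and the algorithm irrevocably assigns fractional values $x_e\ge0$ to them (they cannot be changed later), subject to $\sum_{e\ni u}x_e\le1$ for every vertex $u$. The matched portion of a vertex $u$ is $\sum_{e\ni u}x_e$.
   Formalization: The fractional values $x_e$ that the algorithm assigns to the edges, in both stages of the construction, are rational. -}

module Defs where

open import Data.Nat as ℕ using (ℕ; zero; suc; NonZero; _≤ᵇ_; _<ᵇ_; _∸_)
open import Data.Nat.Properties using (m*n≢0)
open import Data.Integer using (+_)
open import Data.Fin using (Fin; toℕ; _<_)
open import Data.Bool using (Bool; true; false; if_then_else_; not)
open import Data.Rational using (ℚ; 0ℚ; 1ℚ; _+_; _*_; _/_; _≤_)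
open import Data.Product using (_×_)
open import Relation.Binary.PropositionalEquality using (_≡_)
open import Relation.Nullary using (¬_)

sumQ : (m : ℕ) → (Fin m → ℚ) → ℚ
sumQ zero    f = 0ℚ
sumQ (suc m) f = f Fin.zero + sumQ m (λ a → f (Fin.suc a))
  where import Data.Fin as Fin

sumWhere : (m : ℕ) → (Fin m → Bool) → (Fin m → ℚ) → ℚ
sumWhere m p f = sumQ m (λ a → if p a then f a else 0ℚ)

countB : (m : ℕ) → (Fin m → Bool) → ℕ
countB zero    p = 0
countB (suc m) p = (if p Fin.zero then 1 else 0) ℕ.+ countB m (λ a → p (Fin.suc a))
  where import Data.Fin as Fin

avg : ℚ → (m : ℕ) → .{{NonZero m}} → ℚ
avg s m = s * (+ 1 / m)

ℕ→ℚ : ℕ → ℚ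
ℕ→ℚ m = + m / 1

-- B_i = {(i , b) | b : Fin k} for i : Fin n (0-indexed).
-- x a b : value of the first-stage edge {a,b} of the complete bipartite
--         graph on A, where side a = true and side b = false.
-- y i b a : value of the edge between vertex (i , b) of B_i and a ∈ A.

module Construction (n k : ℕ) where

  N : ℕ
  N = n ℕ.* k

  degA : (Fin N → Fin N → ℚ) → Fin N → ℚ
  degA x a = sumQ N (λ b → x a b + x b a)

  portionAt : (Fin N → Fin N → ℚ) → (Fin n → Fin k → Fin N → ℚ) →
              Fin n → Fin N → ℚ
  portionAt x y i a =
    degA x a + sumWhere n (λ j → toℕ j ≤ᵇ toℕ i) (λ j → sumQ k (λ b → y j b a))

  portionA : (Fin N → Fin N → ℚ) → (Fin n → Fin k → Fin N → ℚ) → Fin N → ℚ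
  portionA x y a = degA x a + sumQ n (λ j → sumQ k (λ b → y j b a))

  portionB : (Fin n → Fin k → Fin N → ℚ) → Fin n → Fin k → ℚ
  portionB y i b = sumQ N (λ a → y i b a)

  record Run : Set where
    field
      side     : Fin N → Bool
      balanced : countB N side ≡ countB N (λ a → not (side a))
      x        : Fin N → Fin N → ℚ
      x-nonneg : ∀ a b → 0ℚ ≤ x a b
      x-edge   : ∀ a b → ¬ (side a ≡ true × side b ≡ false) → x a b ≡ 0ℚ
      y        : Fin n → Fin k → Fin N → ℚ
      y-nonneg : ∀ i b a → 0ℚ ≤ y i b a
      Asel     : Fin n → Fin N → Bool
      y-edge   : ∀ i b a j → j < i → Asel j a ≡ true → y i b a ≡ 0ℚ
      capA     : ∀ a → portionA x y a ≤ 1ℚ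
      capB     : ∀ i b → portionB y i b ≤ 1ℚ
      A-sub    : ∀ i a j → j < i → Asel i a ≡ true → Asel j a ≡ false
      A-size   : ∀ i → countB N (Asel i) ≡ k
      A-least  : ∀ i a a' → Asel i a ≡ true → Asel i a' ≡ false →
                 (∀ j → j < i → Asel j a' ≡ false) →
                 portionAt x y i a ≤ portionAt x y i a'

  module _ .{{_ : NonZero n}} .{{_ : NonZero k}} (r : Run) where
    open Run r

    γ : ℚ
    γ = avg (sumQ N (degA x)) N {{m*n≢0 n k}}

    α : Fin n → ℚ
    α i = avg (sumWhere N (Asel i) (portionA x y)) k

    β : Fin n → ℚ
    β i = avg (sumQ k (portionB y i)) k

module Submission where

open import Algebra.Bundles using (CommutativeRing)
import Algebra.Properties.CommutativeMonoid.Sum as CommutativeMonoidSum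
import Algebra.Properties.Semiring.Sum as SemiringSum
open import Data.Bool using (Bool; true; false; if_then_else_; not; T)
open import Data.Fin using (Fin; toℕ; zero; suc)
import Data.Fin.Properties as FinP
import Data.Integer as ℤ
import Data.Integer.Properties as ℤP
open import Data.Integer.Tactic.RingSolver using (solve-∀)
open import Data.Nat as ℕ using (ℕ; zero; suc; NonZero; _≤ᵇ_; _<ᵇ_; _∸_)
import Data.Nat.Properties as ℕP
open import Data.Product using (_×_; _,_)
open import Data.Rational using (ℚ; 0ℚ; 1ℚ; _+_; _*_; _/_; _≤_; toℚᵘ; Positive; NonNegative)
open import Data.Rational.Properties
open import Data.Rational.Solver using (module +-*-Solver)
import Data.Rational.Unnormalised as ℚᵘ
import Data.Rational.Unnormalised.Properties as ℚᵘP
open import Data.Sum using (inj₁; inj₂)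
open import Function using (_∘_)
open import Relation.Binary using (tri<; tri≈; tri>)
open import Relation.Binary.PropositionalEquality
open import Relation.Nullary using (contradiction)

open import Defs

-- The blocks A_1, …, A_n are disjoint k-subsets of the nk-set A, so they partition it
-- and k·Σ α_j is the total matched portion of A. That total splits into the first-stage
-- part, k·nγ, and the part coming from B_1, …, B_n, k·Σ β_j: this is (2).
-- For (1), look at the moment right after B_i arrives. Blocks A_j with j ≤ i already
-- have their final portions, because no later B is adjacent to them; and every later
-- block A_j is, on average, at least as matched as A_i, which consists of k least
-- matched vertices at that moment. So replacing the later blocks by (n − i + 1) copies
-- of A_i only decreases the total matched portion of A at that moment, which is the
-- first-stage mass plus the mass of B_1, …, B_i.

toℚᵘ-/ : ∀ a b → toℚᵘ (ℤ.+ a / suc b) ℚᵘ.≃ ℚᵘ.mkℚᵘ (ℤ.+ a) b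
toℚᵘ-/ a b = toℚᵘ-fromℚᵘ (ℚᵘ.mkℚᵘ (ℤ.+ a) b)

ℕ→ℚ-suc : ∀ m → ℕ→ℚ (suc m) ≡ 1ℚ + ℕ→ℚ m
ℕ→ℚ-suc m = toℚᵘ-injective (begin
  toℚᵘ (ℕ→ℚ (suc m))                           ≈⟨ toℚᵘ-/ (suc m) 0 ⟩
  ℚᵘ.mkℚᵘ (ℤ.+ suc m) 0                        ≈⟨ ℚᵘ.*≡* (one+ (ℤ.+ m)) ⟨
  ℚᵘ.mkℚᵘ (ℤ.+ 1) 0 ℚᵘ.+ ℚᵘ.mkℚᵘ (ℤ.+ m) 0     ≈⟨ ℚᵘP.+-cong (toℚᵘ-/ 1 0) (toℚᵘ-/ m 0) ⟨
  toℚᵘ 1ℚ ℚᵘ.+ toℚᵘ (ℕ→ℚ m)                    ≈⟨ toℚᵘ-homo-+ 1ℚ (ℕ→ℚ m) ⟨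
  toℚᵘ (1ℚ + ℕ→ℚ m)                            ∎)
  where
  open ℚᵘP.≃-Reasoning
  one+ : ∀ z → (ℤ.1ℤ ℤ.* ℤ.1ℤ ℤ.+ z ℤ.* ℤ.1ℤ) ℤ.* ℤ.1ℤ ≡ (ℤ.1ℤ ℤ.+ z) ℤ.* ℤ.1ℤ
  one+ = solve-∀

ℕ→ℚ-* : ∀ a b → ℕ→ℚ (a ℕ.* b) ≡ ℕ→ℚ a * ℕ→ℚ b
ℕ→ℚ-* a b = toℚᵘ-injective (begin
  toℚᵘ (ℕ→ℚ (a ℕ.* b))                         ≈⟨ toℚᵘ-/ (a ℕ.* b) 0 ⟩
  ℚᵘ.mkℚᵘ (ℤ.+ (a ℕ.* b)) 0                    ≈⟨ ℚᵘ.*≡* (cong (ℤ._* ℤ.1ℤ) (ℤP.pos-* a b)) ⟩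
  ℚᵘ.mkℚᵘ (ℤ.+ a) 0 ℚᵘ.* ℚᵘ.mkℚᵘ (ℤ.+ b) 0     ≈⟨ ℚᵘP.*-cong (toℚᵘ-/ a 0) (toℚᵘ-/ b 0) ⟨
  toℚᵘ (ℕ→ℚ a) ℚᵘ.* toℚᵘ (ℕ→ℚ b)               ≈⟨ toℚᵘ-homo-* (ℕ→ℚ a) (ℕ→ℚ b) ⟨
  toℚᵘ (ℕ→ℚ a * ℕ→ℚ b)                         ∎)
  where open ℚᵘP.≃-Reasoning

ℕ→ℚ*1/≡1 : ∀ m .{{_ : NonZero m}} → ℕ→ℚ m * (ℤ.+ 1 / m) ≡ 1ℚ
ℕ→ℚ*1/≡1 (suc m) = toℚᵘ-injective (begin
  toℚᵘ (ℕ→ℚ (suc m) * (ℤ.+ 1 / suc m))          ≈⟨ toℚᵘ-homo-* (ℕ→ℚ (suc m)) (ℤ.+ 1 / suc m) ⟩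
  toℚᵘ (ℕ→ℚ (suc m)) ℚᵘ.* toℚᵘ (ℤ.+ 1 / suc m)  ≈⟨ ℚᵘP.*-cong (toℚᵘ-/ (suc m) 0) (toℚᵘ-/ 1 m) ⟩
  ℚᵘ.mkℚᵘ (ℤ.+ suc m) 0 ℚᵘ.* ℚᵘ.mkℚᵘ (ℤ.+ 1) m  ≈⟨ ℚᵘP.*-inverseʳ (ℚᵘ.mkℚᵘ (ℤ.+ suc m) 0) ⟩
  toℚᵘ 1ℚ                                       ∎)
  where open ℚᵘP.≃-Reasoning

ℕ→ℚ-pos : ∀ m .{{_ : NonZero m}} → Positive (ℕ→ℚ m)
ℕ→ℚ-pos (suc m) = normalize-pos (suc m) 1

1/-nonNeg : ∀ m .{{_ : NonZero m}} → NonNegative (ℤ.+ 1 / m)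
1/-nonNeg m = normalize-nonNeg 1 m

ℕ→ℚ*1/[m*n]≡1/n : ∀ m n .{{_ : NonZero m}} .{{_ : NonZero n}} →
                  ℕ→ℚ m * (ℤ.+ 1 / (m ℕ.* n)) {{ℕP.m*n≢0 m n}} ≡ ℤ.+ 1 / n
ℕ→ℚ*1/[m*n]≡1/n m n = begin
  ℕ→ℚ m * v                  ≡⟨ *-identityʳ _ ⟨
  ℕ→ℚ m * v * 1ℚ             ≡⟨ cong (ℕ→ℚ m * v *_) (ℕ→ℚ*1/≡1 n) ⟨
  ℕ→ℚ m * v * (ℕ→ℚ n * u)    ≡⟨ solve 4 (λ a b v u → a :* v :* (b :* u) := (a :* b :* v) :* u) refl (ℕ→ℚ m) (ℕ→ℚ n) v u ⟩
  ℕ→ℚ m * ℕ→ℚ n * v * u      ≡⟨ cong (λ z → z * v * u) (ℕ→ℚ-* m n) ⟨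
  ℕ→ℚ (m ℕ.* n) * v * u      ≡⟨ cong (_* u) (ℕ→ℚ*1/≡1 (m ℕ.* n) {{ℕP.m*n≢0 m n}}) ⟩
  1ℚ * u                     ≡⟨ *-identityˡ u ⟩
  u                          ∎
  where
  open ≡-Reasoning
  open +-*-Solver
  v = (ℤ.+ 1 / (m ℕ.* n)) {{ℕP.m*n≢0 m n}}
  u = ℤ.+ 1 / n

module ℚΣ = SemiringSum (CommutativeRing.semiring +-*-commutativeRing)

sumQ≡∑ : ∀ m (f : Fin m → ℚ) → sumQ m f ≡ ℚΣ.sum f
sumQ≡∑ zero    f = refl
sumQ≡∑ (suc m) f = cong (f zero +_) (sumQ≡∑ m (f ∘ suc))

sumQ-cong : ∀ m {f g : Fin m → ℚ} → f ≗ g → sumQ m f ≡ sumQ m g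
sumQ-cong zero    f≗g = refl
sumQ-cong (suc m) f≗g = cong₂ _+_ (f≗g zero) (sumQ-cong m (f≗g ∘ suc))

sumQ-mono : ∀ m {f g : Fin m → ℚ} → (∀ a → f a ≤ g a) → sumQ m f ≤ sumQ m g
sumQ-mono zero    f≤g = ≤-refl
sumQ-mono (suc m) f≤g = +-mono-≤ (f≤g zero) (sumQ-mono m (f≤g ∘ suc))

sumQ-zero : ∀ m → sumQ m (λ _ → 0ℚ) ≡ 0ℚ
sumQ-zero m = trans (sumQ≡∑ m _) (ℚΣ.sum-replicate-zero m)

sumQ-+ : ∀ m (f g : Fin m → ℚ) → sumQ m (λ a → f a + g a) ≡ sumQ m f + sumQ m g
sumQ-+ m f g = begin
  sumQ m (λ a → f a + g a)  ≡⟨ sumQ≡∑ m _ ⟩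
  ℚΣ.sum (λ a → f a + g a)  ≡⟨ ℚΣ.∑-distrib-+ f g ⟩
  ℚΣ.sum f + ℚΣ.sum g       ≡⟨ cong₂ _+_ (sumQ≡∑ m f) (sumQ≡∑ m g) ⟨
  sumQ m f + sumQ m g       ∎
  where open ≡-Reasoning

sumQ-comm : ∀ m p (f : Fin m → Fin p → ℚ) →
            sumQ m (λ a → sumQ p (f a)) ≡ sumQ p (λ b → sumQ m (λ a → f a b))
sumQ-comm m p f = begin
  sumQ m (λ a → sumQ p (f a))            ≡⟨ sumQ≡∑ m _ ⟩
  ℚΣ.sum (λ a → sumQ p (f a))            ≡⟨ ℚΣ.sum-cong-≗ (λ a → sumQ≡∑ p (f a)) ⟩
  ℚΣ.sum (λ a → ℚΣ.sum (f a))            ≡⟨ ℚΣ.∑-comm f ⟩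
  ℚΣ.sum (λ b → ℚΣ.sum (λ a → f a b))    ≡⟨ ℚΣ.sum-cong-≗ (λ b → sumQ≡∑ m (λ a → f a b)) ⟨
  ℚΣ.sum (λ b → sumQ m (λ a → f a b))    ≡⟨ sumQ≡∑ p _ ⟨
  sumQ p (λ b → sumQ m (λ a → f a b))    ∎
  where open ≡-Reasoning

sumQ-*ˡ : ∀ m c (f : Fin m → ℚ) → sumQ m (λ a → c * f a) ≡ c * sumQ m f
sumQ-*ˡ m c f = begin
  sumQ m (λ a → c * f a)    ≡⟨ sumQ≡∑ m _ ⟩
  ℚΣ.sum (λ a → c * f a)    ≡⟨ ℚΣ.*-distribˡ-sum c f ⟨
  c * ℚΣ.sum f              ≡⟨ cong (c *_) (sumQ≡∑ m f) ⟨
  c * sumQ m f              ∎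
  where open ≡-Reasoning

sumQ-*ʳ : ∀ m c (f : Fin m → ℚ) → sumQ m (λ a → f a * c) ≡ sumQ m f * c
sumQ-*ʳ m c f = begin
  sumQ m (λ a → f a * c)    ≡⟨ sumQ≡∑ m _ ⟩
  ℚΣ.sum (λ a → f a * c)    ≡⟨ ℚΣ.*-distribʳ-sum c f ⟨
  ℚΣ.sum f * c              ≡⟨ cong (_* c) (sumQ≡∑ m f) ⟨
  sumQ m f * c              ∎
  where open ≡-Reasoning

sumWhere-mono : ∀ m (p : Fin m → Bool) {f g : Fin m → ℚ} →
                (∀ a → p a ≡ true → f a ≤ g a) → sumWhere m p f ≤ sumWhere m p g
sumWhere-mono m p {f} {g} f≤g = sumQ-mono m pointwise
  where
  pointwise : ∀ a → (if p a then f a else 0ℚ) ≤ (if p a then g a else 0ℚ)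
  pointwise a with p a in pa
  ... | true  = f≤g a pa
  ... | false = ≤-refl

sumWhere-cong : ∀ m (p : Fin m → Bool) {f g : Fin m → ℚ} → f ≗ g → sumWhere m p f ≡ sumWhere m p g
sumWhere-cong m p f≗g = sumQ-cong m (λ a → cong (λ z → if p a then z else 0ℚ) (f≗g a))

sumWhere-*ˡ : ∀ m p c (f : Fin m → ℚ) → sumWhere m p (λ a → c * f a) ≡ c * sumWhere m p f
sumWhere-*ˡ m p c f = trans (sumQ-cong m (λ a → if-* (p a) (f a))) (sumQ-*ˡ m c _)
  where
  if-* : ∀ b x → (if b then c * x else 0ℚ) ≡ c * (if b then x else 0ℚ)
  if-* true  x = refl
  if-* false x = sym (*-zeroʳ c)

sumWhere-*ʳ : ∀ m p c (f : Fin m → ℚ) → sumWhere m p (λ a → f a * c) ≡ sumWhere m p f * c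
sumWhere-*ʳ m p c f = begin
  sumWhere m p (λ a → f a * c)  ≡⟨ sumWhere-cong m p (λ a → *-comm (f a) c) ⟩
  sumWhere m p (λ a → c * f a)  ≡⟨ sumWhere-*ˡ m p c f ⟩
  c * sumWhere m p f            ≡⟨ *-comm c _ ⟩
  sumWhere m p f * c            ∎
  where open ≡-Reasoning

sumWhere-const : ∀ m p c → sumWhere m p (λ _ → c) ≡ ℕ→ℚ (countB m p) * c
sumWhere-const zero    p c = sym (*-zeroˡ c)
sumWhere-const (suc m) p c with p zero | sumWhere-const m (p ∘ suc) c
... | true  | ih = begin
  c + sumWhere m (p ∘ suc) (λ _ → c)  ≡⟨ cong (c +_) ih ⟩
  c + ℕ→ℚ count * c                   ≡⟨ cong (_+ ℕ→ℚ count * c) (*-identityˡ c) ⟨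
  1ℚ * c + ℕ→ℚ count * c              ≡⟨ *-distribʳ-+ c 1ℚ (ℕ→ℚ count) ⟨
  (1ℚ + ℕ→ℚ count) * c                ≡⟨ cong (_* c) (ℕ→ℚ-suc count) ⟨
  ℕ→ℚ (suc count) * c                 ∎
  where
  open ≡-Reasoning
  count = countB m (p ∘ suc)
... | false | ih = trans (+-identityˡ _) ih

sumQ-sumWhere-comm : ∀ m n p (f : Fin m → Fin n → ℚ) →
                     sumQ m (λ a → sumWhere n p (f a)) ≡ sumWhere n p (λ j → sumQ m (λ a → f a j))
sumQ-sumWhere-comm m n p f = trans (sumQ-comm m n _) (sumQ-cong n (λ j → sumQ-if (p j) j))
  where
  sumQ-if : ∀ b j → sumQ m (λ a → if b then f a j else 0ℚ) ≡ (if b then sumQ m (λ a → f a j) else 0ℚ)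
  sumQ-if true  j = refl
  sumQ-if false j = sumQ-zero m

sumQ-split : ∀ m p (f : Fin m → ℚ) → sumQ m f ≡ sumWhere m p f + sumWhere m (not ∘ p) f
sumQ-split m p f = trans (sumQ-cong m (λ a → split (p a) (f a))) (sumQ-+ m _ _)
  where
  split : ∀ b x → x ≡ (if b then x else 0ℚ) + (if not b then x else 0ℚ)
  split true  x = sym (+-identityʳ x)
  split false x = sym (+-identityˡ x)

sumWhere-dominated : ∀ m (p q : Fin m → Bool) (f : Fin m → ℚ) →
                     (∀ a a′ → p a ≡ true → q a′ ≡ true → f a ≤ f a′) →
                     ℕ→ℚ (countB m q) * sumWhere m p f ≤ ℕ→ℚ (countB m p) * sumWhere m q f
sumWhere-dominated m p q f dominated = begin
  ℕ→ℚ (countB m q) * sumWhere m p f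
    ≡⟨ sumWhere-*ˡ m p (ℕ→ℚ (countB m q)) f ⟨
  sumWhere m p (λ a → ℕ→ℚ (countB m q) * f a)
    ≡⟨ sumWhere-cong m p (λ a → sumWhere-const m q (f a)) ⟨
  sumWhere m p (λ a → sumWhere m q (λ _ → f a))
    ≤⟨ sumWhere-mono m p (λ a pa → sumWhere-mono m q (λ a′ qa′ → dominated a a′ pa qa′)) ⟩
  sumWhere m p (λ _ → sumWhere m q f)
    ≡⟨ sumWhere-const m p (sumWhere m q f) ⟩
  ℕ→ℚ (countB m p) * sumWhere m q f ∎
  where open ≤-Reasoning

module ℕΣ = CommutativeMonoidSum ℕP.+-0-commutativeMonoid

countB≡∑ : ∀ m (p : Fin m → Bool) → countB m p ≡ ℕΣ.sum (λ a → if p a then 1 else 0)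
countB≡∑ zero    p = refl
countB≡∑ (suc m) p = cong ((if p zero then 1 else 0) ℕ.+_) (countB≡∑ m (p ∘ suc))

∑-countB-comm : ∀ m n (P : Fin m → Fin n → Bool) →
                ℕΣ.sum (λ a → countB n (P a)) ≡ ℕΣ.sum (λ j → countB m (λ a → P a j))
∑-countB-comm m n P = begin
  ℕΣ.sum (λ a → countB n (P a))
    ≡⟨ ℕΣ.sum-cong-≗ (λ a → countB≡∑ n (P a)) ⟩
  ℕΣ.sum (λ a → ℕΣ.sum (λ j → if P a j then 1 else 0))
    ≡⟨ ℕΣ.∑-comm (λ a j → if P a j then 1 else 0) ⟩
  ℕΣ.sum (λ j → ℕΣ.sum (λ a → if P a j then 1 else 0))
    ≡⟨ ℕΣ.sum-cong-≗ (λ j → countB≡∑ m (λ a → P a j)) ⟨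
  ℕΣ.sum (λ j → countB m (λ a → P a j))                ∎
  where open ≡-Reasoning

∑-const : ∀ n c → ℕΣ.sum {n} (λ _ → c) ≡ n ℕ.* c
∑-const zero    c = refl
∑-const (suc n) c = cong (c ℕ.+_) (∑-const n c)

∑≤length : ∀ m (f : Fin m → ℕ) → (∀ a → f a ℕ.≤ 1) → ℕΣ.sum f ℕ.≤ m
∑≤length zero    f f≤1 = ℕ.z≤n
∑≤length (suc m) f f≤1 = ℕP.+-mono-≤ (f≤1 zero) (∑≤length m (f ∘ suc) (f≤1 ∘ suc))

∑≡length⇒≡1 : ∀ m (f : Fin m → ℕ) → (∀ a → f a ℕ.≤ 1) → ℕΣ.sum f ≡ m → ∀ a → f a ≡ 1
∑≡length⇒≡1 (suc m) f f≤1 ∑f≡m a with f zero in f0 | f≤1 zero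
... | 0 | _ = contradiction (∑≤length m (f ∘ suc) (f≤1 ∘ suc)) (ℕP.<⇒≱ (ℕP.≤-reflexive (sym ∑f≡m)))
... | 1 | _ with a
...   | zero  = f0
...   | suc a = ∑≡length⇒≡1 m (f ∘ suc) (f≤1 ∘ suc) (ℕP.suc-injective ∑f≡m) a
∑≡length⇒≡1 (suc m) f f≤1 ∑f≡m a | suc (suc _) | ℕ.s≤s ()

countB-≡0 : ∀ m (p : Fin m → Bool) → (∀ a → p a ≡ false) → countB m p ≡ 0
countB-≡0 zero    p p≡false = refl
countB-≡0 (suc m) p p≡false rewrite p≡false zero = countB-≡0 m (p ∘ suc) (p≡false ∘ suc)

countB-≤1 : ∀ m (p : Fin m → Bool) → (∀ a b → p a ≡ true → p b ≡ true → a ≡ b) → countB m p ℕ.≤ 1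
countB-≤1 zero    p unique = ℕ.z≤n
countB-≤1 (suc m) p unique with p zero in p0
... | true  = ℕP.≤-reflexive (cong suc (countB-≡0 m (p ∘ suc) others-false))
  where
  others-false : ∀ a → p (suc a) ≡ false
  others-false a with p (suc a) in pa
  ... | true  = contradiction (unique zero (suc a) p0 pa) λ ()
  ... | false = refl
... | false = countB-≤1 m (p ∘ suc) (λ a b pa pb → FinP.suc-injective (unique (suc a) (suc b) pa pb))

countB-≥ : ∀ n m → countB n (λ j → not (toℕ j <ᵇ m)) ≡ n ∸ m
countB-≥ zero    zero    = refl
countB-≥ zero    (suc m) = refl
countB-≥ (suc n) zero    = cong suc (countB-≥ n zero)
countB-≥ (suc n) (suc m) = countB-≥ n m

<ᵇ≡true⇒< : ∀ m n → (m <ᵇ n) ≡ true → m ℕ.< n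
<ᵇ≡true⇒< m n m<ᵇn = ℕP.<ᵇ⇒< m n (subst T (sym m<ᵇn) _)

not-<ᵇ≡true⇒≥ : ∀ m n → not (m <ᵇ n) ≡ true → n ℕ.≤ m
not-<ᵇ≡true⇒≥ m n m≮ᵇn with m <ᵇ n in m<ᵇn
... | false = ℕP.≮⇒≥ (λ m<n → subst T m<ᵇn (ℕP.<⇒<ᵇ m<n))

disjoint-cover : ∀ n k (A : Fin n → Fin (n ℕ.* k) → Bool) →
                 (∀ i j a → A i a ≡ true → A j a ≡ true → i ≡ j) →
                 (∀ j → countB (n ℕ.* k) (A j) ≡ k) →
                 ∀ a → countB n (λ j → A j a) ≡ 1
disjoint-cover n k A disjoint size =
  ∑≡length⇒≡1 (n ℕ.* k) multiplicity (λ a → countB-≤1 n (λ j → A j a) (λ i j → disjoint i j a)) total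
  where
  multiplicity : Fin (n ℕ.* k) → ℕ
  multiplicity a = countB n (λ j → A j a)
  total : ℕΣ.sum multiplicity ≡ n ℕ.* k
  total = begin
    ℕΣ.sum multiplicity                    ≡⟨ ∑-countB-comm (n ℕ.* k) n (λ a j → A j a) ⟩
    ℕΣ.sum (λ j → countB (n ℕ.* k) (A j))  ≡⟨ ℕΣ.sum-cong-≗ size ⟩
    ℕΣ.sum {n} (λ _ → k)                   ≡⟨ ∑-const n k ⟩
    n ℕ.* k                                ∎
    where open ≡-Reasoning

sumQ-blocks : ∀ n m (A : Fin n → Fin m → Bool) → (∀ a → countB n (λ j → A j a) ≡ 1) →
              ∀ g → sumQ n (λ j → sumWhere m (A j) g) ≡ sumQ m g
sumQ-blocks n m A cover g = trans (sumQ-comm n m _) (sumQ-cong m once)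
  where
  once : ∀ a → sumWhere n (λ j → A j a) (λ _ → g a) ≡ g a
  once a = begin
    sumWhere n (λ j → A j a) (λ _ → g a)        ≡⟨ sumWhere-const n (λ j → A j a) (g a) ⟩
    ℕ→ℚ (countB n (λ j → A j a)) * g a          ≡⟨ cong (λ c → ℕ→ℚ c * g a) (cover a) ⟩
    1ℚ * g a                                    ≡⟨ *-identityˡ (g a) ⟩
    g a                                         ∎
    where open ≡-Reasoning

module Run-properties (n k : ℕ) .{{_ : NonZero n}} .{{_ : NonZero k}} (r : Construction.Run n k) where
  open Construction n k
  open Run r

  Asel-disjoint : ∀ i j a → Asel i a ≡ true → Asel j a ≡ true → i ≡ j
  Asel-disjoint i j a ai aj with FinP.<-cmp i j
  ... | tri< i<j _ _ = contradiction (trans (sym ai) (A-sub j a i i<j aj)) λ ()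
  ... | tri≈ _ i≡j _ = i≡j
  ... | tri> _ _ j<i = contradiction (trans (sym aj) (A-sub i a j j<i ai)) λ ()

  sumQ-Asel-blocks : ∀ g → sumQ n (λ j → sumWhere N (Asel j) g) ≡ sumQ N g
  sumQ-Asel-blocks = sumQ-blocks n N Asel (disjoint-cover n k Asel Asel-disjoint A-size)

  -- portionA x y = portionWhere (λ _ → true) and
  -- portionAt x y i = portionWhere (λ j → toℕ j ≤ᵇ toℕ i) hold definitionally.
  portionWhere : (Fin n → Bool) → Fin N → ℚ
  portionWhere p a = degA x a + sumWhere n p (λ j → sumQ k (λ b → y j b a))

  firstStage : ℚ
  firstStage = sumQ N (degA x)

  massB : Fin n → ℚ
  massB j = sumQ k (portionB y j)

  sumQ-portionWhere : ∀ p → sumQ N (portionWhere p) ≡ firstStage + sumWhere n p massB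
  sumQ-portionWhere p = begin
    sumQ N (portionWhere p)
      ≡⟨ sumQ-+ N (degA x) _ ⟩
    firstStage + sumQ N (λ a → sumWhere n p (λ j → sumQ k (λ b → y j b a)))
      ≡⟨ cong (firstStage +_) (sumQ-sumWhere-comm N n p _) ⟩
    firstStage + sumWhere n p (λ j → sumQ N (λ a → sumQ k (λ b → y j b a)))
      ≡⟨ cong (firstStage +_) (sumWhere-cong n p (λ j → sumQ-comm N k _)) ⟩
    firstStage + sumWhere n p massB ∎
    where open ≡-Reasoning

  massA : Fin n → ℚ
  massA j = sumWhere N (Asel j) (portionA x y)

  massAt : Fin n → Fin n → ℚ
  massAt i j = sumWhere N (Asel j) (portionAt x y i)

  portionA≡portionAt : ∀ i j a → toℕ j ℕ.≤ toℕ i → Asel j a ≡ true →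
                       portionA x y a ≡ portionAt x y i a
  portionA≡portionAt i j a j≤i aj = cong (degA x a +_) (sumQ-cong n later-vanish)
    where
    later-vanish : ∀ j′ → sumQ k (λ b → y j′ b a)
                          ≡ (if toℕ j′ ≤ᵇ toℕ i then sumQ k (λ b → y j′ b a) else 0ℚ)
    later-vanish j′ with toℕ j′ ≤ᵇ toℕ i in j′≤ᵇi
    ... | true  = refl
    ... | false = trans (sumQ-cong k (λ b → y-edge j′ b a j j<j′ aj)) (sumQ-zero k)
      where
      j<j′ : toℕ j ℕ.< toℕ j′
      j<j′ = ℕP.≤-<-trans j≤i (ℕP.≰⇒> λ j′≤i → subst T j′≤ᵇi (ℕP.≤⇒≤ᵇ j′≤i))

  massA≤massAt : ∀ i j → toℕ j ℕ.≤ toℕ i → massA j ≤ massAt i j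
  massA≤massAt i j j≤i = sumWhere-mono N (Asel j) (λ a aj → ≤-reflexive (portionA≡portionAt i j a j≤i aj))

  massAt-least : ∀ i j → toℕ i ℕ.< toℕ j → massAt i i ≤ massAt i j
  massAt-least i j i<j = *-cancelˡ-≤-pos (ℕ→ℚ k) {{ℕ→ℚ-pos k}}
    (subst₂ (λ c c′ → ℕ→ℚ c * massAt i i ≤ ℕ→ℚ c′ * massAt i j) (A-size j) (A-size i)
      (sumWhere-dominated N (Asel i) (Asel j) (portionAt x y i) least))
    where
    least : ∀ a a′ → Asel i a ≡ true → Asel j a′ ≡ true → portionAt x y i a ≤ portionAt x y i a′
    least a a′ ai a′j = A-least i a a′ ai (A-sub j a′ i i<j a′j)
                          (λ j′ j′<i → A-sub j a′ j′ (ℕP.<-trans j′<i i<j) a′j)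

  massA≤massAt-later : ∀ i j → toℕ i ℕ.≤ toℕ j → massA i ≤ massAt i j
  massA≤massAt-later i j i≤j with ℕP.m≤n⇒m<n∨m≡n i≤j
  ... | inj₁ i<j = ≤-trans (massA≤massAt i i ℕP.≤-refl) (massAt-least i j i<j)
  ... | inj₂ i≡j = subst (λ j → massA i ≤ massAt i j) (FinP.toℕ-injective i≡j) (massA≤massAt i i ℕP.≤-refl)

  mass-inequality : ∀ i → sumWhere n (λ j → toℕ j <ᵇ toℕ i) massA + ℕ→ℚ (n ∸ toℕ i) * massA i
                          ≤ firstStage + sumWhere n (λ j → toℕ j ≤ᵇ toℕ i) massB
  mass-inequality i = begin
    sumWhere n before massA + ℕ→ℚ (n ∸ toℕ i) * massA i
      ≡⟨ cong (sumWhere n before massA +_) count-later ⟨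
    sumWhere n before massA + sumWhere n later (λ _ → massA i)
      ≤⟨ +-mono-≤ (sumWhere-mono n before λ j j<i → massA≤massAt i j (ℕP.<⇒≤ (<ᵇ≡true⇒< _ _ j<i)))
                  (sumWhere-mono n later λ j j≮i → massA≤massAt-later i j (not-<ᵇ≡true⇒≥ _ _ j≮i)) ⟩
    sumWhere n before (massAt i) + sumWhere n later (massAt i)
      ≡⟨ sumQ-split n before (massAt i) ⟨
    sumQ n (massAt i)
      ≡⟨ sumQ-Asel-blocks (portionAt x y i) ⟩
    sumQ N (portionAt x y i)
      ≡⟨ sumQ-portionWhere (λ j → toℕ j ≤ᵇ toℕ i) ⟩
    firstStage + sumWhere n (λ j → toℕ j ≤ᵇ toℕ i) massB ∎
    where
    open ≤-Reasoning
    before later : Fin n → Bool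
    before j = toℕ j <ᵇ toℕ i
    later = not ∘ before
    count-later : sumWhere n later (λ _ → massA i) ≡ ℕ→ℚ (n ∸ toℕ i) * massA i
    count-later = trans (sumWhere-const n later (massA i)) (cong (λ c → ℕ→ℚ c * massA i) (countB-≥ n (toℕ i)))

  mass-equality : sumQ n massA ≡ firstStage + sumQ n massB
  mass-equality = trans (sumQ-Asel-blocks (portionA x y)) (sumQ-portionWhere (λ _ → true))

  1/k : ℚ
  1/k = ℤ.+ 1 / k

  n*γ≡firstStage*1/k : ℕ→ℚ n * γ r ≡ firstStage * 1/k
  n*γ≡firstStage*1/k = begin
    ℕ→ℚ n * (firstStage * v)  ≡⟨ solve 3 (λ a t v → a :* (t :* v) := t :* (a :* v)) refl (ℕ→ℚ n) firstStage v ⟩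
    firstStage * (ℕ→ℚ n * v)  ≡⟨ cong (firstStage *_) (ℕ→ℚ*1/[m*n]≡1/n n k) ⟩
    firstStage * 1/k          ∎
    where
    open ≡-Reasoning
    open +-*-Solver
    v = (ℤ.+ 1 / N) {{ℕP.m*n≢0 n k}}

  averaged-inequality : ∀ i → sumWhere n (λ j → toℕ j <ᵇ toℕ i) (α r) + ℕ→ℚ (n ∸ toℕ i) * α r i
                              ≤ sumWhere n (λ j → toℕ j ≤ᵇ toℕ i) (β r) + ℕ→ℚ n * γ r
  averaged-inequality i = begin
    sumWhere n before (α r) + c * (massA i * 1/k)
      ≡⟨ cong₂ _+_ (sumWhere-*ʳ n before 1/k massA) (sym (*-assoc c (massA i) 1/k)) ⟩
    sumWhere n before massA * 1/k + c * massA i * 1/k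
      ≡⟨ *-distribʳ-+ 1/k (sumWhere n before massA) (c * massA i) ⟨
    (sumWhere n before massA + c * massA i) * 1/k
      ≤⟨ *-monoʳ-≤-nonNeg 1/k {{1/-nonNeg k}} (mass-inequality i) ⟩
    (firstStage + sumWhere n upto massB) * 1/k
      ≡⟨ *-distribʳ-+ 1/k firstStage _ ⟩
    firstStage * 1/k + sumWhere n upto massB * 1/k
      ≡⟨ cong₂ _+_ n*γ≡firstStage*1/k (sumWhere-*ʳ n upto 1/k massB) ⟨
    ℕ→ℚ n * γ r + sumWhere n upto (β r)
      ≡⟨ +-comm (ℕ→ℚ n * γ r) (sumWhere n upto (β r)) ⟩
    sumWhere n upto (β r) + ℕ→ℚ n * γ r ∎
    where
    open ≤-Reasoning
    c = ℕ→ℚ (n ∸ toℕ i)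
    before upto : Fin n → Bool
    before j = toℕ j <ᵇ toℕ i
    upto j = toℕ j ≤ᵇ toℕ i

  averaged-equality : sumQ n (α r) ≡ ℕ→ℚ n * γ r + sumQ n (β r)
  averaged-equality = begin
    sumQ n (α r)                            ≡⟨ sumQ-*ʳ n 1/k massA ⟩
    sumQ n massA * 1/k                      ≡⟨ cong (_* 1/k) mass-equality ⟩
    (firstStage + sumQ n massB) * 1/k       ≡⟨ *-distribʳ-+ 1/k firstStage _ ⟩
    firstStage * 1/k + sumQ n massB * 1/k   ≡⟨ cong₂ _+_ n*γ≡firstStage*1/k (sumQ-*ʳ n 1/k massB) ⟨
    ℕ→ℚ n * γ r + sumQ n (β r)              ∎
    where open ≡-Reasoning

-- Inequality (1) holds for the last block as well.
mainTheorem6 : (n k : ℕ) → .{{_ : NonZero n}} → .{{_ : NonZero k}} →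
    (r : Construction.Run n k) →
    let open Construction n k in
    ((i : Fin n) → ℕ.suc (toℕ i) ℕ.< n →
        sumWhere n (λ j → toℕ j <ᵇ toℕ i) (α r) + ℕ→ℚ (n ∸ toℕ i) * α r i
          ≤ sumWhere n (λ j → toℕ j ≤ᵇ toℕ i) (β r) + ℕ→ℚ n * γ r)
    × (sumQ n (α r) ≡ ℕ→ℚ n * γ r + sumQ n (β r))
mainTheorem6 n k r = (λ i _ → averaged-inequality i) , averaged-equality
  where open Run-properties n k r
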